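{- For any integer $k$ with $1 \le k \le n$, $|\mathrm{Substr}_T(k)| = |D_k|$.
   Context: Let $T$ be a string of length $n$ over an alphabet $\Sigma$, and for $k\ge1$ let $\mathrm{Substr}_T(k)$ be the set of distinct substrings of $T$ of length $k$. A run of $T$ is a maximal substring $T[i..j]$ consisting of a single repeated character; a position $i$ is a run boundary if some run of $T$ starts at $i$. The r-suffix trie $\mathcal{T}$ of $T$ is the (uncompacted) trie of all suffixes $T[i..n]$ such that $i$ is a run boundary; its nodes correspond one-to-one to the prefixes of these suffixes (including the empty prefix at the root). For a node $v$, $\mathsf{str}(v)$ is the string spelled by the path from the root to $v$, and $\mathsf{d}(v)=|\mathsf{str}(v)|$. For a character $c$ and integer $e\ge 0$, $c^e$ denotes $c$ repeated $e$ times. A node $v$ is a matching node for a non-empty string $w$ iff $\mathsf{str}(v) = w[1]^e w$ for some integer $e \ge 0$; the deepest matching node for $w$ is the matching node for $w$ of maximum depth (when one exists). $D_k$ denotes the set of nodes of $\mathcal{T}$ that are the deepest matching node for some string of length $k$. -}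

module Defs where

open import Data.Nat using (ℕ; suc; _≤_)
open import Data.List using (List; []; _∷_; _++_; length; replicate)
open import Data.Product using (Σ; ∃; ∃-syntax; _×_)
open import Data.Empty using (⊥)
open import Relation.Binary.PropositionalEquality using (_≡_)
open import Relation.Nullary using (¬_)

module _ {A : Set} where

  IsSubstr : List A → List A → Set
  IsSubstr s T = ∃[ u ] ∃[ v ] (u ++ s ++ v ≡ T)

  Substr : List A → ℕ → List A → Set
  Substr T k s = length s ≡ k × IsSubstr s T

  NotEndsWith : A → List A → Set
  NotEndsWith c u = ¬ (∃[ u' ] (u' ++ c ∷ [] ≡ u))

  NotStartsWith : A → List A → Set
  NotStartsWith c v = ¬ (∃[ v' ] (c ∷ v' ≡ v))

  -- A run of T: T = u ++ c^m ++ v with m ≥ 1, maximal (u does not end with c,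
  -- v does not start with c).  The run starts at position |u| + 1, so the
  -- suffix of T starting at that run boundary is c^m ++ v.
  RunBoundarySuffix : List A → List A → Set
  RunBoundarySuffix T s =
    ∃[ u ] ∃[ c ] ∃[ m ] ∃[ v ]
      ( (u ++ replicate (suc m) c ++ v ≡ T)
      × NotEndsWith c u
      × NotStartsWith c v
      × (s ≡ replicate (suc m) c ++ v) )

  -- Nodes of the r-suffix trie of T, identified with the strings str(v) they
  -- spell: exactly the prefixes of suffixes of T starting at run boundaries.
  Node : List A → List A → Set
  Node T p = ∃[ s ] (RunBoundarySuffix T s × ∃[ q ] (p ++ q ≡ s))

  Matching : List A → List A → List A → Set
  Matching T []       v = ⊥
  Matching T (c ∷ w') v = Node T v × ∃[ e ] (v ≡ replicate e c ++ c ∷ w')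

  DeepestMatching : List A → List A → List A → Set
  DeepestMatching T w v =
    Matching T w v × (∀ v' → Matching T w v' → length v' ≤ length v)

  InD : List A → ℕ → List A → Set
  InD T k v = Node T v × ∃[ w ] (length w ≡ k × DeepestMatching T w v)

-- A length-k substring w = c w′ corresponds to its deepest matching node c^e w, and conversely a
-- node of D_k determines w as its suffix of length k; matching nodes for the same w differ only in
-- e, so this correspondence is one-to-one.  A matching node exists because an occurrence of w can
-- be extended to the left through the maximal block of c's before it, which starts at a run
-- boundary.  With no decidable equality on the alphabet, the maximal block and the deepest node
-- exist only in the double-negation monad; this suffices because the conclusion is a decidable
-- statement about natural numbers.
module Submission where

open import Defs
open import Data.Nat using (ℕ; zero; suc; _+_; _≤_; _≤?_; z≤n; s≤s)
open import Data.Nat.Properties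
  using (module ≤-Reasoning; suc-injective; ≤-trans; ≤-antisym; +-cancelʳ-≡; +-monoˡ-≤; m≤m+n; ≤∧≢⇒<; m<1+n⇒m≤n)
open import Data.List using (List; []; _∷_; _++_; length; replicate; lookup)
open import Data.List.Properties
  using (∷-injectiveˡ; ∷-injectiveʳ; ++-assoc; length-++; length-replicate; length-++-≤ˡ; length-++-≤ʳ)
open import Data.List.Membership.Propositional using (_∈_; lose)
open import Data.List.Membership.Propositional.Properties using (∈-lookup)
import Data.List.Relation.Unary.All as All
open import Data.List.Relation.Unary.AllPairs using (_∷_)
open import Data.List.Relation.Unary.Any using (Any; index)
open import Data.List.Relation.Unary.Any.Properties using (lookup-index)
open import Data.List.Relation.Unary.Unique.Propositional using (Unique)
open import Data.Fin using (Fin)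
open import Data.Fin.Properties using (injective⇒≤)
open import Data.Product using (∃; ∃-syntax; _×_; _,_; proj₁)
open import Function using (_∘_; flip; case_of_)
open import Function.Bundles using (_⇔_; Equivalence)
open import Function.Definitions using (Injective)
open import Level using (0ℓ)
open import Effect.Monad using (RawMonad)
open import Relation.Nullary using (¬_; yes; no)
open import Relation.Nullary.Decidable using (decidable-stable; ¬¬-excluded-middle)
open import Relation.Nullary.Negation using (¬¬-Monad; contradiction)
open import Relation.Binary.PropositionalEquality using (_≡_; refl; sym; trans; cong; subst; subst₂; module ≡-Reasoning)

open Equivalence
open RawMonad (¬¬-Monad {0ℓ})

Unique⇒lookup-injective : {X : Set} {xs : List X} → Unique xs → Injective _≡_ _≡_ (lookup xs)
Unique⇒lookup-injective (_ ∷ _)    {Fin.zero}  {Fin.zero}  _  = refl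
Unique⇒lookup-injective (x∉ ∷ _)   {Fin.zero}  {Fin.suc j} eq = contradiction eq (All.lookup x∉ (∈-lookup j))
Unique⇒lookup-injective (x∉ ∷ _)   {Fin.suc i} {Fin.zero}  eq = contradiction (sym eq) (All.lookup x∉ (∈-lookup i))
Unique⇒lookup-injective (_ ∷ uniq) {Fin.suc i} {Fin.suc j} eq = cong Fin.suc (Unique⇒lookup-injective uniq eq)

module _ {X Y : Set} where

  length-≤-of-injective : (R : X → Y → Set) {xs : List X} {ys : List Y} → Unique xs →
                          (∀ {x x′ y} → R x y → R x′ y → x ≡ x′) →
                          (∀ {x} → x ∈ xs → Any (R x) ys) →
                          length xs ≤ length ys
  length-≤-of-injective R {xs} {ys} uniq R-injective total = injective⇒≤ image-injective
    where
    image : Fin (length xs) → Fin (length ys)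
    image i = index (total (∈-lookup i))

    related : ∀ i → R (lookup xs i) (lookup ys (image i))
    related i = lookup-index (total (∈-lookup i))

    image-injective : Injective _≡_ _≡_ image
    image-injective {i} {j} eq = Unique⇒lookup-injective uniq
      (R-injective (related i) (subst (R _ ∘ lookup ys) (sym eq) (related j)))

  length-≤-of-¬¬-injective : (R : X → Y → Set) {xs : List X} {ys : List Y} → Unique xs →
                             (∀ {x x′ y} → R x y → R x′ y → x ≡ x′) →
                             (∀ {x} → x ∈ xs → ¬ ¬ Any (R x) ys) →
                             length xs ≤ length ys
  length-≤-of-¬¬-injective R uniq R-injective ¬¬total = decidable-stable (_ ≤? _) do
    total ← All.sequenceM 0ℓ ¬¬-Monad (All.tabulate ¬¬total)
    pure (length-≤-of-injective R uniq R-injective (All.lookup total))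

length-≡-of-one-to-one : {X Y : Set} (R : X → Y → Set) {xs : List X} {ys : List Y} →
                         Unique xs → Unique ys →
                         (∀ {x x′ y} → R x y → R x′ y → x ≡ x′) →
                         (∀ {x y y′} → R x y → R x y′ → y ≡ y′) →
                         (∀ {x} → x ∈ xs → ¬ ¬ Any (R x) ys) →
                         (∀ {y} → y ∈ ys → ¬ ¬ Any (flip R y) xs) →
                         length xs ≡ length ys
length-≡-of-one-to-one R uniq-xs uniq-ys injective functional total surjective = ≤-antisym
  (length-≤-of-¬¬-injective R uniq-xs injective total)
  (length-≤-of-¬¬-injective (flip R) uniq-ys functional surjective)

¬¬-bounded-maximum : {P : ℕ → Set} (N : ℕ) → (∀ e → P e → e ≤ N) → ∃ P →
                     ¬ ¬ (∃[ e ] (P e × ∀ e′ → P e′ → e′ ≤ e))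
¬¬-bounded-maximum zero bounded (e , pe) = pure (e , pe , λ e′ pe′ → ≤-trans (bounded e′ pe′) z≤n)
¬¬-bounded-maximum {P} (suc N) bounded witness = do
  P[1+N]? ← ¬¬-excluded-middle {A = P (suc N)}
  case P[1+N]? of λ
    { (yes p) → pure (suc N , p , bounded)
    ; (no ¬p) → ¬¬-bounded-maximum N (λ e pe → m<1+n⇒m≤n (≤∧≢⇒< (bounded e pe) (λ { refl → ¬p pe }))) witness
    }

module _ {A : Set} where

  replicate-suc-+ : ∀ m n (c : A) → replicate (suc (m + n)) c ≡ replicate m c ++ c ∷ replicate n c
  replicate-suc-+ zero    n c = refl
  replicate-suc-+ (suc m) n c = cong (c ∷_) (replicate-suc-+ m n c)

  length-replicate-++ : ∀ e (c : A) xs → length (replicate e c ++ xs) ≡ e + length xs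
  length-replicate-++ e c xs = trans (length-++ (replicate e c)) (cong (_+ length xs) (length-replicate e))

  ++-cancelˡ-length : ∀ (xs zs : List A) {ys ws} → length xs ≡ length zs → xs ++ ys ≡ zs ++ ws → ys ≡ ws
  ++-cancelˡ-length []       []       _   eq = eq
  ++-cancelˡ-length (_ ∷ xs) (_ ∷ zs) len eq = ++-cancelˡ-length xs zs (suc-injective len) (∷-injectiveʳ eq)

  ++-cancelʳ-length : ∀ (xs zs : List A) {ys ws} → xs ++ ys ≡ zs ++ ws → length ys ≡ length ws → ys ≡ ws
  ++-cancelʳ-length xs zs {ys} {ws} eq len = ++-cancelˡ-length xs zs (+-cancelʳ-≡ (length ys) _ _ (begin
    length xs + length ys  ≡⟨ length-++ xs ⟨
    length (xs ++ ys)      ≡⟨ cong length eq ⟩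
    length (zs ++ ws)      ≡⟨ length-++ zs ⟩
    length zs + length ws  ≡⟨ cong (length zs +_) len ⟨
    length zs + length ys  ∎)) eq
    where open ≡-Reasoning

  IsSubstr-length-≤ : ∀ {s T : List A} → IsSubstr s T → length s ≤ length T
  IsSubstr-length-≤ {s} {T} (u , v , u++s++v≡T) = begin
    length s              ≤⟨ length-++-≤ˡ s ⟩
    length (s ++ v)       ≤⟨ length-++-≤ʳ (s ++ v) {u} ⟩
    length (u ++ s ++ v)  ≡⟨ cong length u++s++v≡T ⟩
    length T              ∎
    where open ≤-Reasoning

  IsSubstr-suffix : ∀ xs {ys T : List A} → IsSubstr (xs ++ ys) T → IsSubstr ys T
  IsSubstr-suffix xs {ys} {T} (u , v , occurrence) = u ++ xs , v , (begin
    (u ++ xs) ++ ys ++ v  ≡⟨ ++-assoc u xs (ys ++ v) ⟩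
    u ++ xs ++ ys ++ v    ≡⟨ cong (u ++_) (++-assoc xs ys v) ⟨
    u ++ (xs ++ ys) ++ v  ≡⟨ occurrence ⟩
    T                     ∎)
    where open ≡-Reasoning

  Node⇒IsSubstr : ∀ {T p : List A} → Node T p → IsSubstr p T
  Node⇒IsSubstr (_ , (u , _ , _ , _ , u++s≡T , _ , _ , s≡run) , q , refl) =
    u , q , trans (cong (u ++_) s≡run) u++s≡T

  Node-length-≤ : ∀ {T p : List A} → Node T p → length p ≤ length T
  Node-length-≤ = IsSubstr-length-≤ ∘ Node⇒IsSubstr

  TrailingRun : A → List A → Set
  TrailingRun c u = ∃[ u′ ] ∃[ j ] (u ≡ u′ ++ replicate j c × NotEndsWith c u′)

  LeadingRun : A → List A → Set
  LeadingRun c v = ∃[ i ] ∃[ v′ ] (v ≡ replicate i c ++ v′ × NotStartsWith c v′)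

  []-notEndsWith : {c : A} → NotEndsWith c []
  []-notEndsWith ([]    , ())
  []-notEndsWith (_ ∷ _ , ())

  [x]-notEndsWith : {c x : A} → ¬ x ≡ c → NotEndsWith c (x ∷ [])
  [x]-notEndsWith x≢c ([]        , eq) = x≢c (sym (∷-injectiveˡ eq))
  [x]-notEndsWith x≢c (_ ∷ [] , ())
  [x]-notEndsWith x≢c (_ ∷ _ ∷ _ , ())

  ∷-notEndsWith : {c x y : A} {ys : List A} → NotEndsWith c (y ∷ ys) → NotEndsWith c (x ∷ y ∷ ys)
  ∷-notEndsWith ¬ends ([]     , ())
  ∷-notEndsWith ¬ends (_ ∷ u′ , eq) = ¬ends (u′ , ∷-injectiveʳ eq)

  ¬¬-trailingRun : (c : A) (u : List A) → ¬ ¬ TrailingRun c u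
  ¬¬-trailingRun c []      = pure ([] , 0 , refl , []-notEndsWith)
  ¬¬-trailingRun c (x ∷ u) = ¬¬-trailingRun c u >>= extend
    where
    extend : TrailingRun c u → ¬ ¬ TrailingRun c (x ∷ u)
    extend (y ∷ ys , j , eq , ¬ends) = pure (x ∷ y ∷ ys , j , cong (x ∷_) eq , ∷-notEndsWith ¬ends)
    extend ([]     , j , eq , ¬ends) = do
      x≟c ← ¬¬-excluded-middle {A = x ≡ c}
      pure (case x≟c of λ
        { (yes refl) → [] , suc j , cong (c ∷_) eq , ¬ends
        ; (no x≢c)   → x ∷ [] , j , cong (x ∷_) eq , [x]-notEndsWith x≢c
        })

  ¬¬-leadingRun : (c : A) (v : List A) → ¬ ¬ LeadingRun c v
  ¬¬-leadingRun c []      = pure (0 , [] , refl , λ ())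
  ¬¬-leadingRun c (x ∷ v) = do
    x≟c ← ¬¬-excluded-middle {A = x ≡ c}
    case x≟c of λ
      { (yes refl) → do
          (i , v′ , eq , ¬starts) ← ¬¬-leadingRun c v
          pure (suc i , v′ , cong (c ∷_) eq , ¬starts)
      ; (no x≢c) → pure (0 , x ∷ v , refl , λ (_ , eq) → x≢c (sym (∷-injectiveˡ eq)))
      }

  matchingNode-of-runs : ∀ {T c w u v} → u ++ c ∷ w ++ v ≡ T →
                         TrailingRun c u → LeadingRun c (w ++ v) →
                         ∃[ e ] Node T (replicate e c ++ c ∷ w)
  matchingNode-of-runs {T} {c} {w} {u} {v} occurrence (u′ , j , u≡u′++cʲ , ¬ends) (i , v′ , w++v≡cⁱ++v′ , ¬starts) =
    j , run , (u′ , c , j + i , v′ , u′++run≡T , ¬ends , ¬starts , refl) , v , sym run≡cʲcw++v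
    where
    open ≡-Reasoning
    run : List A
    run = replicate (suc (j + i)) c ++ v′

    run≡cʲcw++v : run ≡ (replicate j c ++ c ∷ w) ++ v
    run≡cʲcw++v = begin
      replicate (suc (j + i)) c ++ v′            ≡⟨ cong (_++ v′) (replicate-suc-+ j i c) ⟩
      (replicate j c ++ c ∷ replicate i c) ++ v′ ≡⟨ ++-assoc (replicate j c) (c ∷ replicate i c) v′ ⟩
      replicate j c ++ c ∷ replicate i c ++ v′   ≡⟨ cong (λ z → replicate j c ++ c ∷ z) w++v≡cⁱ++v′ ⟨
      replicate j c ++ c ∷ w ++ v                ≡⟨ ++-assoc (replicate j c) (c ∷ w) v ⟨
      (replicate j c ++ c ∷ w) ++ v              ∎

    u′++run≡T : u′ ++ run ≡ T
    u′++run≡T = begin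
      u′ ++ run                            ≡⟨ cong (u′ ++_) run≡cʲcw++v ⟩
      u′ ++ (replicate j c ++ c ∷ w) ++ v  ≡⟨ cong (u′ ++_) (++-assoc (replicate j c) (c ∷ w) v) ⟩
      u′ ++ replicate j c ++ c ∷ w ++ v    ≡⟨ ++-assoc u′ (replicate j c) (c ∷ w ++ v) ⟨
      (u′ ++ replicate j c) ++ c ∷ w ++ v  ≡⟨ cong (_++ c ∷ w ++ v) u≡u′++cʲ ⟨
      u ++ c ∷ w ++ v                      ≡⟨ occurrence ⟩
      T                                    ∎

  ¬¬-matchingNode : ∀ {T c w} → IsSubstr (c ∷ w) T → ¬ ¬ (∃[ e ] Node T (replicate e c ++ c ∷ w))
  ¬¬-matchingNode {c = c} {w} (u , v , occurrence) = do
    trailing ← ¬¬-trailingRun c u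
    leading  ← ¬¬-leadingRun c (w ++ v)
    pure (matchingNode-of-runs occurrence trailing leading)

  ¬¬-deepestMatching : ∀ {T c w} → IsSubstr (c ∷ w) T → ¬ ¬ ∃ (DeepestMatching T (c ∷ w))
  ¬¬-deepestMatching {T} {c} {w} occurrence = do
    witness ← ¬¬-matchingNode occurrence
    (e , node , maximal) ← ¬¬-bounded-maximum (length T) depth-bounded witness
    pure (replicate e c ++ c ∷ w , (node , e , refl) , λ { _ (node′ , e′ , refl) → deeper (maximal e′ node′) })
    where
    depth : ∀ e → length (replicate e c ++ c ∷ w) ≡ e + length (c ∷ w)
    depth e = length-replicate-++ e c (c ∷ w)

    depth-bounded : ∀ e → Node T (replicate e c ++ c ∷ w) → e ≤ length T
    depth-bounded e node = ≤-trans (m≤m+n e _) (subst (_≤ length T) (depth e) (Node-length-≤ node))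

    deeper : ∀ {e e′} → e′ ≤ e → length (replicate e′ c ++ c ∷ w) ≤ length (replicate e c ++ c ∷ w)
    deeper {e} {e′} e′≤e = subst₂ _≤_ (sym (depth e′)) (sym (depth e)) (+-monoˡ-≤ _ e′≤e)

  Matching⇒Node : ∀ {T w v : List A} → Matching T w v → Node T v
  Matching⇒Node {w = _ ∷ _} (node , _) = node

  Matching⇒IsSubstr : ∀ {T w v : List A} → Matching T w v → IsSubstr w T
  Matching⇒IsSubstr {w = c ∷ _} (node , e , refl) = IsSubstr-suffix (replicate e c) (Node⇒IsSubstr node)

  Matching-injectiveˡ : ∀ {T w w′ v : List A} → Matching T w v → Matching T w′ v → length w ≡ length w′ → w ≡ w′
  Matching-injectiveˡ {w = c ∷ _} {c′ ∷ _} (_ , e , refl) (_ , e′ , eq) len =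
    ++-cancelʳ-length (replicate e c) (replicate e′ c′) eq len

  Matching-injectiveʳ : ∀ {T w v v′ : List A} → Matching T w v → Matching T w v′ → length v ≡ length v′ → v ≡ v′
  Matching-injectiveʳ {w = c ∷ w} (_ , e , refl) (_ , e′ , refl) len =
    cong (λ n → replicate n c ++ c ∷ w)
      (+-cancelʳ-≡ _ e e′ (trans (sym (length-replicate-++ e c _)) (trans len (length-replicate-++ e′ c _))))

  DeepestMatching-unique : ∀ {T w v v′ : List A} → DeepestMatching T w v → DeepestMatching T w v′ → v ≡ v′
  DeepestMatching-unique (m , maximal) (m′ , maximal′) =
    Matching-injectiveʳ m m′ (≤-antisym (maximal′ _ m) (maximal _ m′))

  ¬¬-deepestMatching-of-Substr : ∀ {T s : List A} {k} → 1 ≤ k → Substr T k s → ¬ ¬ ∃ (DeepestMatching T s)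
  ¬¬-deepestMatching-of-Substr {s = _ ∷ _} _ (_ , occurrence) = ¬¬-deepestMatching occurrence
  ¬¬-deepestMatching-of-Substr {s = []} (s≤s _) (() , _)

lemma3 : {A : Set} (T : List A) (k : ℕ) → 1 ≤ k → k ≤ length T →
         (S D : List (List A)) →
         Unique S → (∀ s → (s ∈ S) ⇔ Substr T k s) →
         Unique D → (∀ v → (v ∈ D) ⇔ InD T k v) →
         length S ≡ length D
lemma3 {A} T k 1≤k _ S D uniq-S S-spec uniq-D D-spec =
  length-≡-of-one-to-one Corresponds uniq-S uniq-D
    (λ (|s|≡k , m , _) (|s′|≡k , m′ , _) → Matching-injectiveˡ m m′ (trans |s|≡k (sym |s′|≡k)))
    (λ (_ , deepest) (_ , deepest′) → DeepestMatching-unique deepest deepest′)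
    substring-corresponds
    node-corresponds
  where
  Corresponds : List A → List A → Set
  Corresponds s v = length s ≡ k × DeepestMatching T s v

  substring-corresponds : ∀ {s} → s ∈ S → ¬ ¬ Any (Corresponds s) D
  substring-corresponds {s} s∈S = do
    let substr@(|s|≡k , _) = to (S-spec s) s∈S
    (v , deepest) ← ¬¬-deepestMatching-of-Substr 1≤k substr
    pure (lose (from (D-spec v) (Matching⇒Node (proj₁ deepest) , s , |s|≡k , deepest)) (|s|≡k , deepest))

  node-corresponds : ∀ {v} → v ∈ D → ¬ ¬ Any (flip Corresponds v) S
  node-corresponds {v} v∈D = do
    let (_ , s , |s|≡k , deepest) = to (D-spec v) v∈D
    pure (lose (from (S-spec s) (|s|≡k , Matching⇒IsSubstr (proj₁ deepest))) (|s|≡k , deepest))
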